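{- Let $\Gamma$ be a signed graph with a cut edge $e=uv$, and write $\Gamma-e=\Gamma_1\,\dot\cup\,\Gamma_2$, where $\Gamma_1$ and $\Gamma_2$ are induced subgraphs of $\Gamma-e$ containing $u$ and $v$, respectively. Then $\eta(\Gamma)\ge\eta(\Gamma_1)+\eta(\Gamma_2)-1$.
   Context: A signed graph $\Gamma=(G,\sigma)$ is a simple graph $G$ with a sign function $\sigma:E(G)\to\{ -1,+1\}$. The net Laplacian matrix is $L^{\pm}(\Gamma)=D^{\pm}(\Gamma)-A(\Gamma)$, where $D^{\pm}(\Gamma)$ is the diagonal matrix of net-degrees $d^{\pm}(v)=d^+(v)-d^-(v)$ (numbers of positive minus negative neighbours in $\Gamma$) and $A(\Gamma)$ is the signed adjacency matrix. $\eta(\Gamma)$ is the multiplicity of $0$ as an eigenvalue of $L^{\pm}(\Gamma)$ (and $\eta(\Gamma_i)$ that of $L^{\pm}(\Gamma_i)$ computed in $\Gamma_i$ itself). A cut edge is an edge whose deletion increases the number of connected components; $\dot\cup$ denotes disjoint union. -}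

module Defs where

open import Data.Nat using (ℕ; zero; suc)
open import Data.Fin using (Fin; zero; suc; _≟_)
open import Data.Bool using (Bool; true; false; _∧_; _∨_; if_then_else_)
open import Data.Rational using (ℚ; 0ℚ; 1ℚ; _+_; _*_; _-_; -_)
open import Relation.Binary.PropositionalEquality using (_≡_; _≢_)
open import Relation.Nullary using (yes; no; ⌊_⌋)

data Sgn : Set where
  pos neg none : Sgn

sgnVal : Sgn → ℚ
sgnVal pos  = 1ℚ
sgnVal neg  = - 1ℚ
sgnVal none = 0ℚ

-- A signed graph on vertex set Fin n is given by its sign function on
-- pairs of vertices (none = not an edge); it is a simple signed graph
-- when this is symmetric and loopless.
SignedGraph : ℕ → Set
SignedGraph n = Fin n → Fin n → Sgn

IsSimpleSigned : ∀ {n} → SignedGraph n → Set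
IsSimpleSigned {n} Γ = (∀ x y → Γ x y ≡ Γ y x) Data.Product.× (∀ x → Γ x x ≡ none)
  where import Data.Product

Adjacent : ∀ {n} → SignedGraph n → Fin n → Fin n → Set
Adjacent Γ x y = Γ x y ≢ none

sumFin : ∀ {n} → (Fin n → ℚ) → ℚ
sumFin {zero}  f = 0ℚ
sumFin {suc n} f = f zero + sumFin (λ i → f (suc i))

adj : ∀ {n} → SignedGraph n → Fin n → Fin n → ℚ
adj Γ x y = sgnVal (Γ x y)

isPos isNeg : Sgn → ℚ
isPos pos = 1ℚ
isPos _   = 0ℚ
isNeg neg = 1ℚ
isNeg _   = 0ℚ

netDeg : ∀ {n} → SignedGraph n → Fin n → ℚ
netDeg Γ x = sumFin (λ y → isPos (Γ x y)) - sumFin (λ y → isNeg (Γ x y))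

netLap : ∀ {n} → SignedGraph n → Fin n → Fin n → ℚ
netLap Γ x y = (if ⌊ x ≟ y ⌋ then netDeg Γ x else 0ℚ) - adj Γ x y

mulVec : ∀ {n} → (Fin n → Fin n → ℚ) → (Fin n → ℚ) → Fin n → ℚ
mulVec M x w = sumFin (λ y → M w y * x y)

deleteEdge : ∀ {n} → SignedGraph n → Fin n → Fin n → SignedGraph n
deleteEdge Γ u v x y =
  if (⌊ x ≟ u ⌋ ∧ ⌊ y ≟ v ⌋) ∨ (⌊ x ≟ v ⌋ ∧ ⌊ y ≟ u ⌋) then none else Γ x y

-- induced subgraph Γ[S] on the vertex set S = {x | S x ≡ true}; it is kept on
-- the ambient index set Fin n, the vertices outside S being simply absent
-- (we only ever use vectors supported on S, see below).
induced : ∀ {n} → SignedGraph n → (Fin n → Bool) → SignedGraph n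
induced Γ S x y = if S x ∧ S y then Γ x y else none

-- A kernel vector of L±(Γ[S]) computed in Γ[S] itself: a vector on the vertex
-- set S (i.e. a vector on Fin n vanishing outside S) killed by L±(Γ[S]) at
-- every vertex of S.
InKernelOn : ∀ {n} → SignedGraph n → (Fin n → Bool) → (Fin n → ℚ) → Set
InKernelOn Γ S x =
  (∀ w → S w ≡ false → x w ≡ 0ℚ) Data.Product.×
  (∀ w → S w ≡ true → mulVec (netLap (induced Γ S)) x w ≡ 0ℚ)
  where import Data.Product

LinIndep : ∀ {n k} → (Fin k → Fin n → ℚ) → Set
LinIndep {n} {k} vs =
  (c : Fin k → ℚ) → (∀ w → sumFin (λ i → c i * vs i w) ≡ 0ℚ) → ∀ i → c i ≡ 0ℚ

-- "η(Γ[S]) ≥ k": the kernel of L±(Γ[S]) (over ℚ) contains k linearly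
-- independent vectors, i.e. its dimension is at least k.
NullityAtLeast : ∀ {n} → SignedGraph n → (Fin n → Bool) → ℕ → Set
NullityAtLeast {n} Γ S k =
  Data.Product.Σ (Fin k → Fin n → ℚ) λ vs →
    (∀ i → InKernelOn Γ S (vs i)) Data.Product.× LinIndep vs
  where import Data.Product

allV : ∀ {n} → Fin n → Bool
allV _ = true

not : Bool → Bool
not true = false
not false = true

{-# OPTIONS --safe #-}
-- Write (L± x)(w) = Σ_y σ(wy) (x w − x y). Kernel vectors of Γ₁ and Γ₂, extended by
-- zero, are kernel vectors of Γ − e because no edge of Γ − e joins the two parts, and
-- together they are k₁ + k₂ independent vectors since their supports are disjoint.
-- The edge e contributes to L±(Γ) only through x u − x v, so the kernel vectors of
-- Γ − e in the hyperplane x u = x v are kernel vectors of Γ, and cutting a space of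
-- dimension k₁ + k₂ with a hyperplane leaves dimension at least k₁ + k₂ − 1.
module Submission where

open import Defs
open import Data.Nat using (ℕ; _+_; _∸_)
open import Data.Fin using (Fin)
open import Data.Bool using (Bool; true; false)
open import Relation.Binary.PropositionalEquality using (_≡_)

open import Algebra.Bundles using (CommutativeRing)
open import Data.Bool using (_∧_; _∨_; if_then_else_; T)
open import Data.Bool.Properties using (T-≡; T-∧; T-∨; ∨-comm; ∧-comm)
open import Data.Fin using (zero; suc; punchIn; splitAt; _↑ˡ_; _↑ʳ_; _≟_)
open import Data.Fin.Properties using (any?; splitAt⁻¹-↑ˡ; splitAt⁻¹-↑ʳ)
open import Data.Nat using (zero; suc)
open import Data.Product using (Σ; _×_; _,_; proj₁; proj₂)
import Data.Product as Product
open import Data.Rational using (ℚ; 0ℚ; 1ℚ; -_; 1/_; _÷_; NonZero; ≢-nonZero)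
  renaming (_+_ to _+ℚ_; _-_ to _-ℚ_; _*_ to _*ℚ_)
import Data.Rational.Properties as ℚ
open import Data.Rational.Solver using (module +-*-Solver)
open import Data.Sum using (inj₁; inj₂)
open import Data.Vec.Functional using (Vector; _++_; take; drop; insertAt; removeAt)
open import Data.Vec.Functional.Properties using (lookup-++ˡ; lookup-++ʳ; insertAt-lookup; insertAt-punchIn)
open import Data.Vec.Functional.Relation.Unary.All.Properties using (++⁺)
open import Function using (_∘_; Equivalence)
open import Relation.Binary.PropositionalEquality using (refl; sym; trans; cong; cong₂; _≗_; module ≡-Reasoning)
open import Relation.Nullary using (yes; no; ⌊_⌋; ¬?)
open import Relation.Nullary.Decidable using (toWitness; decidable-stable)
open import Relation.Unary using (Pred; _∩_)
open import Level using (0ℓ)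

open import Algebra.Properties.Group ℚ.+-0-group using (x∙y⁻¹≈ε⇒x≈y)
open +-*-Solver using (solve; _:+_; _:-_; _:*_; :-_; _:=_)
open import Algebra.Properties.Semiring.Sum (CommutativeRing.semiring ℚ.+-*-commutativeRing)
  using (sum; sum-cong-≗; sum-remove; sum-replicate-zero; *-distribʳ-sum)

sumFin≡sum : ∀ {n} (f : Vector ℚ n) → sumFin f ≡ sum f
sumFin≡sum {zero}  f = refl
sumFin≡sum {suc n} f = cong (f zero +ℚ_) (sumFin≡sum (f ∘ suc))

sumFin-cong : ∀ {n} {f g : Vector ℚ n} → f ≗ g → sumFin f ≡ sumFin g
sumFin-cong {f = f} {g} f≗g =
  trans (sumFin≡sum f) (trans (sum-cong-≗ f≗g) (sym (sumFin≡sum g)))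

sumFin-zeros : ∀ {n} {f : Vector ℚ n} → (∀ i → f i ≡ 0ℚ) → sumFin f ≡ 0ℚ
sumFin-zeros {n} f≡0 =
  trans (sumFin-cong {g = λ _ → 0ℚ} f≡0) (trans (sumFin≡sum {n} (λ _ → 0ℚ)) (sum-replicate-zero n))

sumFin-*ʳ : ∀ {n} (f : Vector ℚ n) c → sumFin (λ i → f i *ℚ c) ≡ sumFin f *ℚ c
sumFin-*ʳ f c =
  trans (sumFin≡sum (λ i → f i *ℚ c))
        (trans (sym (*-distribʳ-sum c f)) (cong (_*ℚ c) (sym (sumFin≡sum f))))

sumFin-punchIn : ∀ {n} (f : Vector ℚ (suc n)) p → sumFin f ≡ f p +ℚ sumFin (removeAt f p)
sumFin-punchIn f p =
  trans (sumFin≡sum f) (trans (sum-remove f) (cong (f p +ℚ_) (sym (sumFin≡sum (removeAt f p)))))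

sumFin-- : ∀ {n} (f g : Vector ℚ n) → sumFin (λ i → f i -ℚ g i) ≡ sumFin f -ℚ sumFin g
sumFin-- {zero}  f g = refl
sumFin-- {suc n} f g =
  trans (cong (f zero -ℚ g zero +ℚ_) (sumFin-- (f ∘ suc) (g ∘ suc)))
        (interchange (f zero) (g zero) (sumFin (f ∘ suc)) (sumFin (g ∘ suc)))
  where
  interchange : ∀ a b c d → (a -ℚ b) +ℚ (c -ℚ d) ≡ (a +ℚ c) -ℚ (b +ℚ d)
  interchange = solve 4 (λ a b c d → (a :- b) :+ (c :- d) := (a :+ c) :- (b :+ d)) refl

sumFin-↑ : ∀ m {n} (f : Vector ℚ (m + n)) →
  sumFin f ≡ sumFin (λ i → f (i ↑ˡ n)) +ℚ sumFin (λ j → f (m ↑ʳ j))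
sumFin-↑ zero    f = sym (ℚ.+-identityˡ _)
sumFin-↑ (suc m) f =
  trans (cong (f zero +ℚ_) (sumFin-↑ m (f ∘ suc))) (sym (ℚ.+-assoc (f zero) _ _))

sumFin-δ : ∀ {n} (w : Fin n) c (x : Vector ℚ n) →
  sumFin (λ y → (if ⌊ w ≟ y ⌋ then c else 0ℚ) *ℚ x y) ≡ c *ℚ x w
sumFin-δ {suc n} zero c x =
  trans (cong (c *ℚ x zero +ℚ_) (sumFin-zeros (λ i → ℚ.*-zeroˡ (x (suc i))))) (ℚ.+-identityʳ _)
sumFin-δ {suc n} (suc w) c x =
  trans (cong (0ℚ *ℚ x zero +ℚ_) (trans (sumFin-cong δ-suc) (sumFin-δ w c (x ∘ suc))))
        (trans (cong (_+ℚ c *ℚ x (suc w)) (ℚ.*-zeroˡ (x zero))) (ℚ.+-identityˡ _))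
  where
  δ-suc : ∀ y → (if ⌊ suc w ≟ suc y ⌋ then c else 0ℚ) *ℚ x (suc y)
              ≡ (if ⌊ w ≟ y ⌋ then c else 0ℚ) *ℚ x (suc y)
  δ-suc y with w ≟ y
  ... | yes _ = refl
  ... | no  _ = refl

infixl 6 _-[_]*_
_-[_]*_ : ∀ {n} → Vector ℚ n → ℚ → Vector ℚ n → Vector ℚ n
(x -[ t ]* y) w = x w -ℚ t *ℚ y w

netLapDiff : ∀ {n} → SignedGraph n → Vector ℚ n → Vector ℚ n
netLapDiff G x w = sumFin (λ y → sgnVal (G w y) *ℚ (x w -ℚ x y))

netDeg≡sumFin-sgnVal : ∀ {n} (G : SignedGraph n) w → netDeg G w ≡ sumFin (λ y → sgnVal (G w y))
netDeg≡sumFin-sgnVal G w =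
  trans (sym (sumFin-- (λ y → isPos (G w y)) (λ y → isNeg (G w y))))
        (sumFin-cong (isPos-isNeg ∘ G w))
  where
  isPos-isNeg : ∀ s → isPos s -ℚ isNeg s ≡ sgnVal s
  isPos-isNeg pos  = refl
  isPos-isNeg neg  = refl
  isPos-isNeg none = refl

mulVec-netLap : ∀ {n} (G : SignedGraph n) x w → mulVec (netLap G) x w ≡ netLapDiff G x w
mulVec-netLap G x w = begin
  sumFin (λ y → (δ y -ℚ adj G w y) *ℚ x y)
    ≡⟨ sumFin-cong (λ y → *-distribʳ-- (δ y) (adj G w y) (x y)) ⟩
  sumFin (λ y → δ y *ℚ x y -ℚ adj G w y *ℚ x y)
    ≡⟨ sumFin-- (λ y → δ y *ℚ x y) (λ y → adj G w y *ℚ x y) ⟩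
  sumFin (λ y → δ y *ℚ x y) -ℚ Ax
    ≡⟨ cong (_-ℚ Ax) (sumFin-δ w (netDeg G w) x) ⟩
  netDeg G w *ℚ x w -ℚ Ax
    ≡⟨ cong (λ d → d *ℚ x w -ℚ Ax) (netDeg≡sumFin-sgnVal G w) ⟩
  sumFin (λ y → sgnVal (G w y)) *ℚ x w -ℚ Ax
    ≡⟨ cong (_-ℚ Ax) (sumFin-*ʳ (sgnVal ∘ G w) (x w)) ⟨
  sumFin (λ y → sgnVal (G w y) *ℚ x w) -ℚ Ax
    ≡⟨ sumFin-- (λ y → sgnVal (G w y) *ℚ x w) (λ y → adj G w y *ℚ x y) ⟨
  sumFin (λ y → sgnVal (G w y) *ℚ x w -ℚ sgnVal (G w y) *ℚ x y)
    ≡⟨ sumFin-cong (λ y → *-distribˡ-- (sgnVal (G w y)) (x w) (x y)) ⟨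
  netLapDiff G x w ∎
  where
  open ≡-Reasoning
  δ : Fin _ → ℚ
  δ y = if ⌊ w ≟ y ⌋ then netDeg G w else 0ℚ
  Ax : ℚ
  Ax = sumFin (λ y → adj G w y *ℚ x y)
  *-distribʳ-- : ∀ a b c → (a -ℚ b) *ℚ c ≡ a *ℚ c -ℚ b *ℚ c
  *-distribʳ-- = solve 3 (λ a b c → (a :- b) :* c := a :* c :- b :* c) refl
  *-distribˡ-- : ∀ s a b → s *ℚ (a -ℚ b) ≡ s *ℚ a -ℚ s *ℚ b
  *-distribˡ-- = solve 3 (λ s a b → s :* (a :- b) := s :* a :- s :* b) refl

InKernel : ∀ {n} → SignedGraph n → Pred (Vector ℚ n) 0ℓ
InKernel G x = ∀ w → netLapDiff G x w ≡ 0ℚ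

netLapDiff-linear : ∀ {n} (G : SignedGraph n) x t y w →
  netLapDiff G (x -[ t ]* y) w ≡ netLapDiff G x w -ℚ t *ℚ netLapDiff G y w
netLapDiff-linear G x t y w = begin
  sumFin (λ z → sgnVal (G w z) *ℚ ((x -[ t ]* y) w -ℚ (x -[ t ]* y) z))
    ≡⟨ sumFin-cong (λ z → regroup (sgnVal (G w z)) (x w) (x z) t (y w) (y z)) ⟩
  sumFin (λ z → sgnVal (G w z) *ℚ (x w -ℚ x z) -ℚ sgnVal (G w z) *ℚ (y w -ℚ y z) *ℚ t)
    ≡⟨ sumFin-- (λ z → sgnVal (G w z) *ℚ (x w -ℚ x z)) (λ z → sgnVal (G w z) *ℚ (y w -ℚ y z) *ℚ t) ⟩
  netLapDiff G x w -ℚ sumFin (λ z → sgnVal (G w z) *ℚ (y w -ℚ y z) *ℚ t)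
    ≡⟨ cong (netLapDiff G x w -ℚ_) (sumFin-*ʳ (λ z → sgnVal (G w z) *ℚ (y w -ℚ y z)) t) ⟩
  netLapDiff G x w -ℚ netLapDiff G y w *ℚ t
    ≡⟨ cong (netLapDiff G x w -ℚ_) (ℚ.*-comm (netLapDiff G y w) t) ⟩
  netLapDiff G x w -ℚ t *ℚ netLapDiff G y w ∎
  where
  open ≡-Reasoning
  regroup : ∀ s a b t c d →
    s *ℚ ((a -ℚ t *ℚ c) -ℚ (b -ℚ t *ℚ d)) ≡ s *ℚ (a -ℚ b) -ℚ s *ℚ (c -ℚ d) *ℚ t
  regroup = solve 6 (λ s a b t c d →
    s :* ((a :- t :* c) :- (b :- t :* d)) := s :* (a :- b) :- s :* (c :- d) :* t) refl

InKernel-closed : ∀ {n} (G : SignedGraph n) x t y → InKernel G x → InKernel G y →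
  InKernel G (x -[ t ]* y)
InKernel-closed G x t y Lx≡0 Ly≡0 w =
  trans (netLapDiff-linear G x t y w)
        (trans (cong₂ (λ a b → a -ℚ t *ℚ b) (Lx≡0 w) (Ly≡0 w)) (cong (0ℚ -ℚ_) (ℚ.*-zeroʳ t)))

IsSymmetric : ∀ {n} → SignedGraph n → Set
IsSymmetric G = ∀ x y → G x y ≡ G y x

NoEdgeLeaving : ∀ {n} → SignedGraph n → (Fin n → Bool) → Set
NoEdgeLeaving G T = ∀ x y → T x ≡ true → T y ≡ false → G x y ≡ none

SupportedIn : ∀ {n} → (Fin n → Bool) → Pred (Vector ℚ n) 0ℓ
SupportedIn T x = ∀ w → T w ≡ false → x w ≡ 0ℚ

not≡true : ∀ {b} → not b ≡ true → b ≡ false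
not≡true {false} _ = refl

not≡false : ∀ {b} → not b ≡ false → b ≡ true
not≡false {true} _ = refl

NoEdgeLeaving-not : ∀ {n} {G : SignedGraph n} {T} → IsSymmetric G → NoEdgeLeaving G T →
  NoEdgeLeaving G (not ∘ T)
NoEdgeLeaving-not G-sym T-closed x y ¬Tx ¬Ty =
  trans (G-sym x y) (T-closed y x (not≡false ¬Ty) (not≡true ¬Tx))

≡⇒*-sub≡0 : ∀ s {a b} → a ≡ b → s *ℚ (a -ℚ b) ≡ 0ℚ
≡⇒*-sub≡0 s {a} refl = trans (cong (s *ℚ_) (ℚ.+-inverseʳ a)) (ℚ.*-zeroʳ s)

induced-agrees : ∀ {n} {G : SignedGraph n} {T x y} → NoEdgeLeaving G T → T x ≡ true →
  induced G T x y ≡ G x y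
induced-agrees {T = T} {x} {y} T-closed Tx rewrite Tx with T y in Ty
... | true  = refl
... | false = sym (T-closed x y Tx Ty)

InKernelOn⇒InKernel : ∀ {n} {G : SignedGraph n} {T x} → IsSymmetric G → NoEdgeLeaving G T →
  InKernelOn G T x → InKernel G x
InKernelOn⇒InKernel {G = G} {T} {x} G-sym T-closed (x∈T , Lx≡0) w with T w in Tw
... | true = begin
  netLapDiff G x w
    ≡⟨ sumFin-cong (λ y → cong (λ s → sgnVal s *ℚ (x w -ℚ x y)) (sym (induced-agrees T-closed Tw))) ⟩
  netLapDiff (induced G T) x w
    ≡⟨ sym (mulVec-netLap (induced G T) x w) ⟩
  mulVec (netLap (induced G T)) x w
    ≡⟨ Lx≡0 w Tw ⟩
  0ℚ ∎
  where open ≡-Reasoning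
... | false = sumFin-zeros outside
  where
  outside : ∀ y → sgnVal (G w y) *ℚ (x w -ℚ x y) ≡ 0ℚ
  outside y with T y in Ty
  ... | true  = trans (cong (λ s → sgnVal s *ℚ (x w -ℚ x y)) (trans (G-sym w y) (T-closed y w Ty Tw)))
                      (ℚ.*-zeroˡ (x w -ℚ x y))
  ... | false = ≡⇒*-sub≡0 (sgnVal (G w y)) (trans (x∈T w Tw) (sym (x∈T y Ty)))

deleteEdge-sym : ∀ {n} {Γ : SignedGraph n} → IsSymmetric Γ → ∀ u v → IsSymmetric (deleteEdge Γ u v)
deleteEdge-sym Γ-sym u v x y
  rewrite ∨-comm (⌊ x ≟ u ⌋ ∧ ⌊ y ≟ v ⌋) (⌊ x ≟ v ⌋ ∧ ⌊ y ≟ u ⌋)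
        | ∧-comm ⌊ x ≟ u ⌋ ⌊ y ≟ v ⌋
        | ∧-comm ⌊ x ≟ v ⌋ ⌊ y ≟ u ⌋
        | Γ-sym x y = refl

InKernel-deleteEdge : ∀ {n} {Γ : SignedGraph n} {u v x} → InKernel (deleteEdge Γ u v) x → x u ≡ x v →
  InKernel Γ x
InKernel-deleteEdge {Γ = Γ} {u} {v} {x} Lx≡0 xu≡xv w = trans (sumFin-cong same-term) (Lx≡0 w)
  where
  both : ∀ {a b c d : Fin _} → T (⌊ a ≟ b ⌋ ∧ ⌊ c ≟ d ⌋) → a ≡ b × c ≡ d
  both {a} {b} {c} {d} a≟b∧c≟d =
    Product.map (toWitness {a? = a ≟ b}) (toWitness {a? = c ≟ d}) (Equivalence.to T-∧ a≟b∧c≟d)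
  endpoints : ∀ {y} → T ((⌊ w ≟ u ⌋ ∧ ⌊ y ≟ v ⌋) ∨ (⌊ w ≟ v ⌋ ∧ ⌊ y ≟ u ⌋)) → x w ≡ x y
  endpoints on-e with Equivalence.to T-∨ on-e
  ... | inj₁ uv = let w≡u , y≡v = both uv in trans (cong x w≡u) (trans xu≡xv (cong x (sym y≡v)))
  ... | inj₂ vu = let w≡v , y≡u = both vu in trans (cong x w≡v) (trans (sym xu≡xv) (cong x (sym y≡u)))
  same-term : ∀ y → sgnVal (Γ w y) *ℚ (x w -ℚ x y) ≡ sgnVal (deleteEdge Γ u v w y) *ℚ (x w -ℚ x y)
  same-term y with (⌊ w ≟ u ⌋ ∧ ⌊ y ≟ v ⌋) ∨ (⌊ w ≟ v ⌋ ∧ ⌊ y ≟ u ⌋) in on-e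
  ... | false = refl
  ... | true  = trans (≡⇒*-sub≡0 (sgnVal (Γ w y)) xw≡xy) (sym (≡⇒*-sub≡0 0ℚ xw≡xy))
    where
    xw≡xy : x w ≡ x y
    xw≡xy = endpoints (Equivalence.from T-≡ on-e)

InKernelOn-allV : ∀ {n} (G : SignedGraph n) {x} → InKernel G x → InKernelOn G allV x
InKernelOn-allV G {x} Lx≡0 = (λ _ ()) , λ w _ → trans (mulVec-netLap G x w) (Lx≡0 w)

difference : ∀ {n} → Fin n → Fin n → Vector ℚ n → ℚ
difference u v x = x u -ℚ x v

difference-linear : ∀ {n} (u v : Fin n) x t y →
  difference u v (x -[ t ]* y) ≡ difference u v x -ℚ t *ℚ difference u v y
difference-linear u v x t y = regroup (x u) (x v) t (y u) (y v)
  where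
  regroup : ∀ a b t c d → (a -ℚ t *ℚ c) -ℚ (b -ℚ t *ℚ d) ≡ (a -ℚ b) -ℚ t *ℚ (c -ℚ d)
  regroup = solve 5 (λ a b t c d → (a :- t :* c) :- (b :- t :* d) := (a :- b) :- t :* (c :- d)) refl

DimAtLeast : ∀ {n} → Pred (Vector ℚ n) 0ℓ → ℕ → Set
DimAtLeast {n} P k = Σ (Fin k → Vector ℚ n) λ vs → (∀ i → P (vs i)) × LinIndep vs

DimAtLeast-mono : ∀ {n k} {P Q : Pred (Vector ℚ n) 0ℓ} → (∀ x → P x → Q x) →
  DimAtLeast P k → DimAtLeast Q k
DimAtLeast-mono P⇒Q (vs , vs∈P , indep) = vs , (λ i → P⇒Q (vs i) (vs∈P i)) , indep

combination : ∀ {n k} → Vector ℚ k → (Fin k → Vector ℚ n) → Vector ℚ n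
combination c vs w = sumFin (λ i → c i *ℚ vs i w)

combination-vanishing : ∀ {n k} (c : Vector ℚ k) (vs : Fin k → Vector ℚ n) w →
  (∀ i → vs i w ≡ 0ℚ) → combination c vs w ≡ 0ℚ
combination-vanishing c vs w vs≡0 =
  sumFin-zeros (λ i → trans (cong (c i *ℚ_) (vs≡0 i)) (ℚ.*-zeroʳ (c i)))

combination-++ : ∀ {n k₁ k₂} (c : Vector ℚ (k₁ + k₂))
  (A : Fin k₁ → Vector ℚ n) (B : Fin k₂ → Vector ℚ n) w →
  combination c (A ++ B) w ≡ combination (take k₁ c) A w +ℚ combination (drop k₁ c) B w
combination-++ {k₁ = k₁} {k₂} c A B w =
  trans (sumFin-↑ k₁ (λ i → c i *ℚ (A ++ B) i w))
        (cong₂ _+ℚ_ (sumFin-cong (λ i → cong (λ z → c (i ↑ˡ k₂) *ℚ z w) (lookup-++ˡ A B i)))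
                    (sumFin-cong (λ j → cong (λ z → c (k₁ ↑ʳ j) *ℚ z w) (lookup-++ʳ A B j))))

take-++-drop : ∀ m {n} {A : Set} (xs : Vector A (m + n)) → take m xs ++ drop m xs ≗ xs
take-++-drop m xs i with splitAt m i in split≡
... | inj₁ j = cong xs (splitAt⁻¹-↑ˡ split≡)
... | inj₂ j = cong xs (splitAt⁻¹-↑ʳ split≡)

LinIndep-++ : ∀ {n k₁ k₂} {S : Fin n → Bool} {A : Fin k₁ → Vector ℚ n} {B : Fin k₂ → Vector ℚ n} →
  (∀ i → SupportedIn S (A i)) → (∀ j → SupportedIn (not ∘ S) (B j)) →
  LinIndep A → LinIndep B → LinIndep (A ++ B)
LinIndep-++ {k₁ = k₁} {S = S} {A} {B} A⊆S B⊆¬S A-indep B-indep c Σ≡0 i =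
  trans (sym (take-++-drop k₁ c i))
        (++⁺ (_≡ 0ℚ) (A-indep (take k₁ c) on-A) (B-indep (drop k₁ c) on-B) i)
  where
  ΣA ΣB : Vector ℚ _
  ΣA = combination (take k₁ c) A
  ΣB = combination (drop k₁ c) B
  ΣA+ΣB≡0 : ∀ w → ΣA w +ℚ ΣB w ≡ 0ℚ
  ΣA+ΣB≡0 w = trans (sym (combination-++ c A B w)) (Σ≡0 w)
  on-A : ∀ w → ΣA w ≡ 0ℚ
  on-A w with S w in Sw
  ... | false = combination-vanishing (take k₁ c) A w (λ i → A⊆S i w Sw)
  ... | true  = begin
    ΣA w          ≡⟨ ℚ.+-identityʳ (ΣA w) ⟨
    ΣA w +ℚ 0ℚ    ≡⟨ cong (ΣA w +ℚ_) (combination-vanishing (drop k₁ c) B w (λ j → B⊆¬S j w (cong not Sw))) ⟨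
    ΣA w +ℚ ΣB w  ≡⟨ ΣA+ΣB≡0 w ⟩
    0ℚ            ∎
    where open ≡-Reasoning
  on-B : ∀ w → ΣB w ≡ 0ℚ
  on-B w with S w in Sw
  ... | true  = combination-vanishing (drop k₁ c) B w (λ j → B⊆¬S j w (cong not Sw))
  ... | false = begin
    ΣB w          ≡⟨ ℚ.+-identityˡ (ΣB w) ⟨
    0ℚ +ℚ ΣB w    ≡⟨ cong (_+ℚ ΣB w) (combination-vanishing (take k₁ c) A w (λ i → A⊆S i w Sw)) ⟨
    ΣA w +ℚ ΣB w  ≡⟨ ΣA+ΣB≡0 w ⟩
    0ℚ            ∎
    where open ≡-Reasoning

DimAtLeast-++ : ∀ {n k₁ k₂} {P : Pred (Vector ℚ n) 0ℓ} (S : Fin n → Bool) →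
  DimAtLeast (P ∩ SupportedIn S) k₁ → DimAtLeast (P ∩ SupportedIn (not ∘ S)) k₂ →
  DimAtLeast P (k₁ + k₂)
DimAtLeast-++ {P = P} S (A , A∈ , A-indep) (B , B∈ , B-indep) =
  A ++ B , ++⁺ P (proj₁ ∘ A∈) (proj₁ ∘ B∈) , LinIndep-++ (proj₂ ∘ A∈) (proj₂ ∘ B∈) A-indep B-indep

combination-insertAt : ∀ {n k} (c : Vector ℚ k) p s (vs : Fin (suc k) → Vector ℚ n) w →
  combination (insertAt c p s) vs w ≡ s *ℚ vs p w +ℚ combination c (removeAt vs p) w
combination-insertAt c p s vs w =
  trans (sumFin-punchIn (λ i → insertAt c p s i *ℚ vs i w) p)
        (cong₂ _+ℚ_ (cong (_*ℚ vs p w) (insertAt-lookup c p s))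
                    (sumFin-cong (λ j → cong (_*ℚ vs (punchIn p j) w) (insertAt-punchIn c p s j))))

combination-shear : ∀ {n k} (c t : Vector ℚ k) (vs : Fin (suc k) → Vector ℚ n) p w →
  combination c (λ j → vs (punchIn p j) -[ t j ]* vs p) w
    ≡ combination c (removeAt vs p) w -ℚ sumFin (λ j → c j *ℚ t j) *ℚ vs p w
combination-shear c t vs p w =
  trans (sumFin-cong (λ j → distrib (c j) (vs (punchIn p j) w) (t j) (vs p w)))
        (trans (sumFin-- (λ j → c j *ℚ vs (punchIn p j) w) (λ j → c j *ℚ t j *ℚ vs p w))
               (cong (combination c (removeAt vs p) w -ℚ_) (sumFin-*ʳ (λ j → c j *ℚ t j) (vs p w))))
  where
  distrib : ∀ c a t b → c *ℚ (a -ℚ t *ℚ b) ≡ c *ℚ a -ℚ c *ℚ t *ℚ b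
  distrib = solve 4 (λ c a t b → c :* (a :- t :* b) := c :* a :- c :* t :* b) refl

-- A relation Σ c j (vs (punchIn p j) − t j vs p) = 0 is the relation among vs with
-- coefficient −Σ c j t j inserted at p.
LinIndep-shear : ∀ {n k} {vs : Fin (suc k) → Vector ℚ n} p (t : Vector ℚ k) →
  LinIndep vs → LinIndep (λ j → vs (punchIn p j) -[ t j ]* vs p)
LinIndep-shear {vs = vs} p t vs-indep c Σ≡0 j =
  trans (sym (insertAt-punchIn c p (- s) j)) (vs-indep (insertAt c p (- s)) lifted (punchIn p j))
  where
  s : ℚ
  s = sumFin (λ j → c j *ℚ t j)
  swap : ∀ s v x → - s *ℚ v +ℚ x ≡ x -ℚ s *ℚ v
  swap = solve 3 (λ s v x → :- s :* v :+ x := x :- s :* v) refl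
  lifted : ∀ w → combination (insertAt c p (- s)) vs w ≡ 0ℚ
  lifted w = begin
    combination (insertAt c p (- s)) vs w
      ≡⟨ combination-insertAt c p (- s) vs w ⟩
    - s *ℚ vs p w +ℚ combination c (removeAt vs p) w
      ≡⟨ swap s (vs p w) (combination c (removeAt vs p) w) ⟩
    combination c (removeAt vs p) w -ℚ s *ℚ vs p w
      ≡⟨ combination-shear c t vs p w ⟨
    combination c (λ j → vs (punchIn p j) -[ t j ]* vs p) w
      ≡⟨ Σ≡0 w ⟩
    0ℚ ∎
    where open ≡-Reasoning

÷-*-cancel : ∀ a b .{{_ : NonZero b}} → (a ÷ b) *ℚ b ≡ a
÷-*-cancel a b = begin
  a *ℚ 1/ b *ℚ b    ≡⟨ ℚ.*-assoc a (1/ b) b ⟩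
  a *ℚ (1/ b *ℚ b)  ≡⟨ cong (a *ℚ_) (ℚ.*-inverseˡ b) ⟩
  a *ℚ 1ℚ           ≡⟨ ℚ.*-identityʳ a ⟩
  a                 ∎
  where open ≡-Reasoning

module _ {n} (P : Pred (Vector ℚ n) 0ℓ)
         (P-closed : ∀ x t y → P x → P y → P (x -[ t ]* y))
         (f : Vector ℚ n → ℚ) (f-linear : ∀ x t y → f (x -[ t ]* y) ≡ f x -ℚ t *ℚ f y) where

  pivot : ∀ {k} (vs : Fin (suc k) → Vector ℚ n) →
    Σ (Fin (suc k)) λ p → Σ (Vector ℚ k) λ t → ∀ j → f (vs (punchIn p j) -[ t j ]* vs p) ≡ 0ℚ
  pivot vs with any? (λ i → ¬? (f (vs i) ℚ.≟ 0ℚ))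
  ... | yes (p , f[vp]≢0) = p , ratio , λ j →
    trans (f-linear (vs (punchIn p j)) (ratio j) (vs p))
          (trans (cong (f (vs (punchIn p j)) -ℚ_) (÷-*-cancel (f (vs (punchIn p j))) (f (vs p))))
                 (ℚ.+-inverseʳ (f (vs (punchIn p j)))))
    where
    instance
      f[vp]-nonZero : NonZero (f (vs p))
      f[vp]-nonZero = ≢-nonZero f[vp]≢0
    ratio : Vector ℚ _
    ratio j = f (vs (punchIn p j)) ÷ f (vs p)
  ... | no ∄ = zero , (λ _ → 0ℚ) , λ j →
    trans (f-linear (vs (suc j)) 0ℚ (vs zero))
          (cong₂ (λ a b → a -ℚ 0ℚ *ℚ b) (f[vs]≡0 (suc j)) (f[vs]≡0 zero))
    where
    f[vs]≡0 : ∀ i → f (vs i) ≡ 0ℚ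
    f[vs]≡0 i = decidable-stable (f (vs i) ℚ.≟ 0ℚ) (λ f[vi]≢0 → ∄ (i , f[vi]≢0))

  DimAtLeast-hyperplane : ∀ {k} → DimAtLeast P k → DimAtLeast (P ∩ (λ x → f x ≡ 0ℚ)) (k ∸ 1)
  DimAtLeast-hyperplane {zero}  _ = (λ ()) , (λ ()) , (λ _ _ ())
  DimAtLeast-hyperplane {suc k} (vs , vs∈P , indep) with pivot vs
  ... | p , t , f≡0 =
    (λ j → vs (punchIn p j) -[ t j ]* vs p) ,
    (λ j → P-closed (vs (punchIn p j)) (t j) (vs p) (vs∈P (punchIn p j)) (vs∈P p) , f≡0 j) ,
    LinIndep-shear {vs = vs} p t indep

lemma3p3 : ∀ {n} (Γ : SignedGraph n) → IsSimpleSigned Γ →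
    (u v : Fin n) → Adjacent Γ u v →
    (S : Fin n → Bool) → S u ≡ true → S v ≡ false →
    (∀ x y → S x ≡ true → S y ≡ false → deleteEdge Γ u v x y ≡ none) →
    (k₁ k₂ : ℕ) →
    NullityAtLeast (deleteEdge Γ u v) S k₁ →
    NullityAtLeast (deleteEdge Γ u v) (λ x → not (S x)) k₂ →
    NullityAtLeast Γ allV (k₁ + k₂ ∸ 1)
lemma3p3 Γ (Γ-sym , _) u v _ S _ _ S-closed k₁ k₂ ker₁ ker₂ =
  DimAtLeast-mono in-kernel-of-Γ
    (DimAtLeast-hyperplane (InKernel Γ-e) (InKernel-closed Γ-e) (difference u v) (difference-linear u v)
      (DimAtLeast-++ {P = InKernel Γ-e} S
        (DimAtLeast-mono (component S-closed) ker₁)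
        (DimAtLeast-mono (component (NoEdgeLeaving-not Γ-e-sym S-closed)) ker₂)))
  where
  Γ-e : SignedGraph _
  Γ-e = deleteEdge Γ u v
  Γ-e-sym : IsSymmetric Γ-e
  Γ-e-sym = deleteEdge-sym Γ-sym u v
  component : ∀ {T} → NoEdgeLeaving Γ-e T → ∀ x → InKernelOn Γ-e T x → (InKernel Γ-e ∩ SupportedIn T) x
  component T-closed x x∈ = InKernelOn⇒InKernel Γ-e-sym T-closed x∈ , proj₁ x∈
  in-kernel-of-Γ : ∀ x → InKernel Γ-e x × difference u v x ≡ 0ℚ → InKernelOn Γ allV x
  in-kernel-of-Γ x (Lx≡0 , xu-xv≡0) =
    InKernelOn-allV Γ (InKernel-deleteEdge Lx≡0 (x∙y⁻¹≈ε⇒x≈y (x u) (x v) xu-xv≡0))
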